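{- Let $\mathbb F$ be a field, $d\ge1$ and $\lambda\in\mathcal S_d$. The set $\mathcal B(\lambda)$ of all bases of $\mathbb F^d$ which are the canonical basis of some flag of $\mathbb F^d$ with length-permutation $\lambda$ is an affine space over $\mathbb F$ of dimension $\mathrm{inv}(\lambda)=\#\{i<j:\lambda(i)>\lambda(j)\}$ (i.e. it is parametrized bijectively by $\mathbb F^{\mathrm{inv}(\lambda)}$).
   Context: A flag of $\mathbb F^d$ is a sequence $V_1\subset\dots\subset V_k$ of subspaces with $0<\dim V_1<\dots<\dim V_k\le d$. The length of a nonzero $v=(x_1,\dots,x_d)$ is the largest $j$ with $x_j\ne0$. Canonical basis and length-permutation of a flag: if $V_k\ne\mathbb F^d$ append $V_{k+1}=\mathbb F^d$; for $i=1,\dots,d$ inductively, let $j$ be the smallest index with $V_j\not\subseteq\mathrm{span}(f_1,\dots,f_{i-1})$, let $f_i$ be the unique element of $V_j$ of minimal length among the nonzero vectors of $V_j$ whose coordinates at positions $\lambda(1),\dots,\lambda(i-1)$ vanish and whose last nonzero coordinate is $1$, and let $\lambda(i)$ be the length of $f_i$. The basis $f_1,\dots,f_d$ is the canonical basis and $\lambda\in\mathcal S_d$ the length-permutation of the flag. -}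

module Defs where

open import Level using (Level; _⊔_; Lift) renaming (suc to lsuc)
open import Data.Nat as ℕ using (ℕ; zero; suc)
open import Data.Fin as Fin using (Fin; zero; suc; fromℕ)
open import Data.Fin.Permutation using (Permutation′; _⟨$⟩ʳ_)
open import Data.Product using (Σ; ∃; _×_; _,_)
open import Data.Sum using (_⊎_)
open import Data.Unit.Polymorphic using (⊤)
open import Relation.Nullary using (¬_; yes; no)
open import Algebra.Bundles using (CommutativeRing)

record Field (c ℓ : Level) : Set (lsuc (c ⊔ ℓ)) where
  field
    commutativeRing : CommutativeRing c ℓ
  open CommutativeRing commutativeRing public
  field
    1≉0 : ¬ (1# ≈ 0#)
    inverse : ∀ x → ¬ (x ≈ 0#) → ∃ λ y → x * y ≈ 1#

sumℕ : ∀ {n} → (Fin n → ℕ) → ℕ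
sumℕ {zero}  g = 0
sumℕ {suc n} g = g zero ℕ.+ sumℕ (λ i → g (suc i))

inv : ∀ {d} → Permutation′ d → ℕ
inv {d} π = sumℕ λ i → sumℕ λ j → indicator i j
  where
  indicator : Fin d → Fin d → ℕ
  indicator i j with i Fin.<? j | (π ⟨$⟩ʳ j) Fin.<? (π ⟨$⟩ʳ i)
  ... | yes _ | yes _ = 1
  ... | _     | _     = 0

-- Linear algebra in F^d, positions indexed by Fin d
-- (position p ∈ Fin d corresponds to the paper's coordinate p+1).

module FieldDefs {c ℓ} (F : Field c ℓ) where
  open Field F using (Carrier; _≈_; _+_; _*_; 0#; 1#)

  Vec : ℕ → Set c
  Vec d = Fin d → Carrier

  _≋_ : ∀ {d} → Vec d → Vec d → Set ℓ
  u ≋ v = ∀ p → u p ≈ v p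

  0v : ∀ {d} → Vec d
  0v _ = 0#

  _+v_ : ∀ {d} → Vec d → Vec d → Vec d
  (u +v v) p = u p + v p

  _·v_ : ∀ {d} → Carrier → Vec d → Vec d
  (a ·v u) p = a * u p

  ∑v : ∀ {n d} → (Fin n → Vec d) → Vec d
  ∑v {zero}  g = 0v
  ∑v {suc n} g = g zero +v ∑v (λ i → g (suc i))

  lincomb : ∀ {n d} → (Fin n → Carrier) → (Fin n → Vec d) → Vec d
  lincomb a g = ∑v (λ k → a k ·v g k)

  record Subspace (d : ℕ) : Set (lsuc (c ⊔ ℓ)) where
    field
      Mem  : Vec d → Set (c ⊔ ℓ)
      resp : ∀ {u v} → u ≋ v → Mem u → Mem v
      0∈   : Mem 0v
      +∈   : ∀ {u v} → Mem u → Mem v → Mem (u +v v)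
      ·∈   : ∀ a {u} → Mem u → Mem (a ·v u)
  open Subspace public

  _⊆_ : ∀ {d} → Subspace d → Subspace d → Set (c ⊔ ℓ)
  U ⊆ W = ∀ v → Mem U v → Mem W v

  Full : ∀ d → Subspace d
  Full d = record { Mem = λ _ → ⊤ ; resp = λ _ _ → _ ; 0∈ = _
                  ; +∈ = λ _ _ → _ ; ·∈ = λ _ _ → _ }

  LinIndep : ∀ {n d} → (Fin n → Vec d) → Set (c ⊔ ℓ)
  LinIndep g = ∀ a → lincomb a g ≋ 0v → ∀ k → a k ≈ 0#

  Spans : ∀ {n d} → Subspace d → (Fin n → Vec d) → Set (c ⊔ ℓ)
  Spans U g = ∀ v → Mem U v → ∃ λ a → v ≋ lincomb a g

  HasDim : ∀ {d} → Subspace d → ℕ → Set (c ⊔ ℓ)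
  HasDim U n = Σ (Fin n → Vec _) λ g →
    (∀ k → Mem U (g k)) × LinIndep g × Spans U g

  IsBasis : ∀ {d} → (Fin d → Vec d) → Set (c ⊔ ℓ)
  IsBasis {d} f = LinIndep f × Spans (Full d) f

  IsFlag : ∀ {d k} → (Fin (suc k) → Subspace d) → Set (c ⊔ ℓ)
  IsFlag {d} {k} V = Σ (Fin (suc k) → ℕ) λ δ →
    (∀ i → HasDim (V i) (δ i)) ×
    (∀ i j → i Fin.< j → V i ⊆ V j) ×
    (∀ i j → i Fin.< j → δ i ℕ.< δ j) ×
    (0 ℕ.< δ zero) × (δ (fromℕ k) ℕ.≤ d)

  append : ∀ {d k} → (Fin (suc k) → Subspace d) → Subspace d →
           Fin (suc (suc k)) → Subspace d
  append {k = zero}  V U zero          = V zero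
  append {k = zero}  V U (suc zero)    = U
  append {k = suc k} V U zero          = V zero
  append {k = suc k} V U (suc i)       = append (λ j → V (suc j)) U i

  HasLength : ∀ {d} → Vec d → Fin d → Set ℓ
  HasLength v p = ¬ (v p ≈ 0#) × (∀ q → p Fin.< q → v q ≈ 0#)

  -- v ∈ span(f_1,…,f_{i-1}) (0-based: span of f k for k < i)
  InSpanBefore : ∀ {d} → (Fin d → Vec d) → Fin d → Vec d → Set (c ⊔ ℓ)
  InSpanBefore f i v = ∃ λ a → (∀ k → i Fin.≤ k → a k ≈ 0#) × v ≋ lincomb a f

  _⊆Span_before_ : ∀ {d} → Subspace d → (Fin d → Vec d) → Fin d → Set (c ⊔ ℓ)
  U ⊆Span f before i = ∀ v → Mem U v → InSpanBefore f i v

  Admissible : ∀ {d} → Subspace d → Permutation′ d → Fin d → Vec d → Fin d →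
               Set (c ⊔ ℓ)
  Admissible U π i v p =
    Mem U v × (∀ k → k Fin.< i → v (π ⟨$⟩ʳ k) ≈ 0#) × HasLength v p × v p ≈ 1#

  -- f is the canonical basis, with length-permutation π, of the
  -- (already completed) sequence W_0 ⊂ … ⊂ W_{m-1}: for each i, with j the
  -- smallest index such that W_j ⊄ span(f_k : k < i), f_i is an element of
  -- W_j of minimal length among the admissible vectors, and its length is π(i).
  -- (Minimality pins f_i down uniquely, as in the paper.)
  IsCanonicalFor : ∀ {d m} → (Fin m → Subspace d) → (Fin d → Vec d) →
                   Permutation′ d → Set (c ⊔ ℓ)
  IsCanonicalFor {d} {m} W f π = ∀ (i : Fin d) → Σ (Fin m) λ j →
    ¬ (W j ⊆Span f before i) ×
    (∀ j′ → j′ Fin.< j → W j′ ⊆Span f before i) ×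
    Admissible (W j) π i (f i) (π ⟨$⟩ʳ i) ×
    (∀ v p → Admissible (W j) π i v p → (π ⟨$⟩ʳ i) Fin.≤ p)

  IsCanonicalBasisOf : ∀ {d k} → (Fin (suc k) → Subspace d) →
                       (Fin d → Vec d) → Permutation′ d → Set (c ⊔ ℓ)
  IsCanonicalBasisOf {d} {k} V f π =
    (Full d ⊆ V (fromℕ k) × IsCanonicalFor V f π) ⊎
    (¬ (Full d ⊆ V (fromℕ k)) × IsCanonicalFor (append V (Full d)) f π)

  InB : ∀ {d} → Permutation′ d → (Fin d → Vec d) → Set (lsuc (c ⊔ ℓ))
  InB {d} π f = IsBasis f × ∃ λ k → Σ (Fin (suc k) → Subspace d) λ V →
    IsFlag V × IsCanonicalBasisOf V f π

  _≋≋_ : ∀ {d} → (Fin d → Vec d) → (Fin d → Vec d) → Set ℓ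
  f ≋≋ g = ∀ i → f i ≋ g i

  IsLinear : ∀ {n d} → (Vec n → (Fin d → Vec d)) → Set (c ⊔ ℓ)
  IsLinear L =
    (∀ x y → x ≋ y → L x ≋≋ L y) ×
    (∀ x y → L (x +v y) ≋≋ (λ i → L x i +v L y i)) ×
    (∀ a x → L (a ·v x) ≋≋ (λ i → a ·v L x i))

  AffineParametrisation : ∀ {ℓ′ d} → ((Fin d → Vec d) → Set ℓ′) → ℕ →
                          Set (c ⊔ ℓ ⊔ ℓ′)
  AffineParametrisation {d = d} P n =
    Σ (Fin d → Vec d) λ b₀ → Σ (Vec n → (Fin d → Vec d)) λ L →
      IsLinear L ×
      let φ = λ x i → b₀ i +v L x i in
      (∀ x → P (φ x)) ×
      (∀ x y → φ x ≋≋ φ y → x ≋ y) ×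
      (∀ f → P f → ∃ λ x → φ x ≋≋ f)

-- Call a family f₀, …, f_{d-1} in F^d echelon (for π) when fᵢ has entry 1 at
-- position π(i), vanishes at the positions π(k) for k < i, and vanishes beyond
-- position π(i).  The proof shows that 𝓑(π) is exactly the set of echelon families:
--   * the admissibility conditions on a canonical basis say that it is echelon;
--   * an echelon family is unitriangular, hence a basis, and it is the canonical
--     basis of the complete flag of spans of its initial segments.
-- Equivalently, f is echelon iff fᵢ(π j) = δᵢⱼ for every pair (i , j) that is not
-- an inversion of π, while the entries at the inv(π) inversions are arbitrary.
-- Hence x ↦ (δᵢⱼ + xᵢⱼ placed at the inversions) is an affine bijection from
-- F^{inv π} onto 𝓑(π).
module Submission where

open import Defs
open import Level using (Level)
open import Data.Nat using (ℕ; _≤_)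
open import Data.Fin.Permutation using (Permutation′)

import Data.Nat as ℕ
open import Data.Fin as Fin using (Fin; zero; suc; toℕ; fromℕ; splitAt; join; _↑ˡ_; _↑ʳ_; cast)
import Data.Fin.Properties as FinP
open import Data.Fin.Permutation using (_⟨$⟩ʳ_; _⟨$⟩ˡ_; inverseˡ; inverseʳ)
open import Data.Product using (Σ; ∃; _×_; _,_; proj₁; proj₂)
open import Data.Sum using (inj₁; inj₂)
open import Data.Empty using (⊥-elim)
open import Function using (_∘_)
open import Relation.Nullary using (¬_; Dec; yes; no)
open import Relation.Nullary.Decidable using (_×-dec_)
open import Relation.Binary.PropositionalEquality as ≡
  using (_≡_; _≢_; module ≡-Reasoning)

sumℕ-cong : ∀ {n} {g h : Fin n → ℕ} → (∀ i → g i ≡ h i) → sumℕ g ≡ sumℕ h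
sumℕ-cong {ℕ.zero}  eq = ≡.refl
sumℕ-cong {ℕ.suc n} eq = ≡.cong₂ ℕ._+_ (eq zero) (sumℕ-cong (eq ∘ suc))

-- Fin (Σᵢ gᵢ) is in bijection with the disjoint union of the Fin gᵢ;
-- this is how parameters indexed by Fin (inv π) are attached to inversions.
split : ∀ {n} (g : Fin n → ℕ) → Fin (sumℕ g) → Σ (Fin n) (Fin ∘ g)
split {ℕ.suc n} g t with splitAt (g zero) t
... | inj₁ u  = zero , u
... | inj₂ t′ = suc (proj₁ (split (g ∘ suc) t′)) , proj₂ (split (g ∘ suc) t′)

merge : ∀ {n} (g : Fin n → ℕ) → Σ (Fin n) (Fin ∘ g) → Fin (sumℕ g)
merge {ℕ.suc n} g (zero  , u) = u ↑ˡ sumℕ (g ∘ suc)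
merge {ℕ.suc n} g (suc i , u) = g zero ↑ʳ merge (g ∘ suc) (i , u)

split-merge : ∀ {n} (g : Fin n → ℕ) p → split g (merge g p) ≡ p
split-merge {ℕ.suc n} g (zero , u)
  rewrite FinP.splitAt-↑ˡ (g zero) u (sumℕ (g ∘ suc)) = ≡.refl
split-merge {ℕ.suc n} g (suc i , u)
  rewrite FinP.splitAt-↑ʳ (g zero) (sumℕ (g ∘ suc)) (merge (g ∘ suc) (i , u))
        | split-merge (g ∘ suc) (i , u) = ≡.refl

merge-split : ∀ {n} (g : Fin n → ℕ) t → merge g (split g t) ≡ t
merge-split {ℕ.suc n} g t with splitAt (g zero) t in eq
... | inj₁ u  = ≡.trans (≡.cong (join _ _) (≡.sym eq)) (FinP.join-splitAt (g zero) _ t)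
... | inj₂ t′ = begin
  g zero ↑ʳ merge (g ∘ suc) (split (g ∘ suc) t′)
    ≡⟨ ≡.cong (g zero ↑ʳ_) (merge-split (g ∘ suc) t′) ⟩
  join (g zero) _ (inj₂ t′)
    ≡⟨ ≡.cong (join _ _) (≡.sym eq) ⟩
  join (g zero) _ (splitAt (g zero) t)
    ≡⟨ FinP.join-splitAt (g zero) _ t ⟩
  t ∎
  where open ≡-Reasoning

-- A decidable proposition counted as 1 (true) or 0 (false); a proof of it
-- is the same thing as an element of Fin (count a?).
count : ∀ {a} {A : Set a} → Dec A → ℕ
count (yes _) = 1
count (no _)  = 0

toCount : ∀ {a} {A : Set a} (a? : Dec A) → A → Fin (count a?)
toCount (yes _) _ = zero
toCount (no ¬a) a = ⊥-elim (¬a a)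

fromCount : ∀ {a} {A : Set a} (a? : Dec A) → Fin (count a?) → A
fromCount (yes a) _ = a

toCount-fromCount : ∀ {a} {A : Set a} (a? : Dec A) u → toCount a? (fromCount a? u) ≡ u
toCount-fromCount (yes _) zero = ≡.refl

toCount-irrelevant : ∀ {a} {A : Set a} (a? : Dec A) x y → toCount a? x ≡ toCount a? y
toCount-irrelevant (yes _) _ _ = ≡.refl
toCount-irrelevant (no ¬a) x _ = ⊥-elim (¬a x)

module Inversions {d} (π : Permutation′ d) where

  Inversion : Fin d → Fin d → Set
  Inversion i j = i Fin.< j × π ⟨$⟩ʳ j Fin.< π ⟨$⟩ʳ i

  inversion? : ∀ i j → Dec (Inversion i j)
  inversion? i j = i Fin.<? j ×-dec π ⟨$⟩ʳ j Fin.<? π ⟨$⟩ʳ i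

  -- The summand of inv π as it occurs in its definition (a with-bound helper
  -- function, which can only be referred to through this equation) …
  invSummand : Σ (Fin d → Fin d → ℕ) λ g → inv π ≡ sumℕ (λ i → sumℕ (g i))
  invSummand = _ , ≡.refl

  invSummand-count : ∀ i j → proj₁ invSummand i j ≡ count (inversion? i j)
  invSummand-count i j with i Fin.<? j | π ⟨$⟩ʳ j Fin.<? π ⟨$⟩ʳ i
  ... | yes _ | yes _ = ≡.refl
  ... | yes _ | no _  = ≡.refl
  ... | no _  | yes _ = ≡.refl
  ... | no _  | no _  = ≡.refl

  Cell : Fin d → Fin d → ℕ
  Cell i j = count (inversion? i j)

  Row : Fin d → ℕ
  Row i = sumℕ (Cell i)

  inv-counts : inv π ≡ sumℕ Row
  inv-counts = ≡.trans (proj₂ invSummand)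
                       (sumℕ-cong (λ i → sumℕ-cong (invSummand-count i)))

  -- An index t is decomposed as a row i, then a column j within that row, and
  -- finally an element of Fin (Cell i j), which is a proof that (i , j) is an inversion.
  row : Fin (inv π) → Σ (Fin d) (Fin ∘ Row)
  row t = split Row (cast inv-counts t)

  column : (t : Fin (inv π)) → Σ (Fin d) (Fin ∘ Cell (proj₁ (row t)))
  column t = split (Cell (proj₁ (row t))) (proj₂ (row t))

  inversionAt : Fin (inv π) → Σ (Fin d) λ i → Σ (Fin d) λ j → Inversion i j
  inversionAt t = i , j , fromCount (inversion? i j) (proj₂ (column t))
    where
    i j : Fin d
    i = proj₁ (row t)
    j = proj₁ (column t)

  indexOf : ∀ {i j} → Inversion i j → Fin (inv π)
  indexOf {i} {j} p =
    cast (≡.sym inv-counts) (merge Row (i , merge (Cell i) (j , toCount (inversion? i j) p)))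

  indexOf-irrelevant : ∀ {i j} (p q : Inversion i j) → indexOf p ≡ indexOf q
  indexOf-irrelevant {i} {j} p q =
    ≡.cong (λ u → cast (≡.sym inv-counts) (merge Row (i , merge (Cell i) (j , u))))
           (toCount-irrelevant (inversion? i j) p q)

  indexOf-inversionAt : ∀ t → let (i , j , _) = inversionAt t in
                        ∀ (p : Inversion i j) → indexOf p ≡ t
  indexOf-inversionAt t p = begin
    cast (≡.sym inv-counts) (merge Row (i , merge (Cell i) (j , toCount (inversion? i j) p)))
      ≡⟨ ≡.cong (λ u → cast (≡.sym inv-counts) (merge Row (i , merge (Cell i) (j , u)))) toCount-p ⟩
    cast (≡.sym inv-counts) (merge Row (i , merge (Cell i) (column t)))
      ≡⟨ ≡.cong (λ s → cast (≡.sym inv-counts) (merge Row (i , s)))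
                (merge-split (Cell i) (proj₂ (row t))) ⟩
    cast (≡.sym inv-counts) (merge Row (row t))
      ≡⟨ ≡.cong (cast (≡.sym inv-counts)) (merge-split Row (cast inv-counts t)) ⟩
    cast (≡.sym inv-counts) (cast inv-counts t)
      ≡⟨ FinP.cast-involutive (≡.sym inv-counts) inv-counts t ⟩
    t ∎
    where
    open ≡-Reasoning
    i j : Fin d
    i = proj₁ (row t)
    j = proj₁ (column t)
    toCount-p : toCount (inversion? i j) p ≡ proj₂ (column t)
    toCount-p = ≡.trans (toCount-irrelevant (inversion? i j) p _)
                        (toCount-fromCount (inversion? i j) (proj₂ (column t)))

  inversionAt-indexOf : ∀ {i j} (p : Inversion i j) →
    let (i′ , j′ , _) = inversionAt (indexOf p) in i′ ≡ i × j′ ≡ j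
  inversionAt-indexOf {i} {j} p = components row≡
    where
    u : Fin (Cell i j)
    u = toCount (inversion? i j) p
    row≡ : row (indexOf p) ≡ (i , merge (Cell i) (j , u))
    row≡ = ≡.trans (≡.cong (split Row) (FinP.cast-involutive inv-counts (≡.sym inv-counts) _))
                   (split-merge Row (i , merge (Cell i) (j , u)))
    components : ∀ {o : Σ (Fin d) (Fin ∘ Row)} → o ≡ (i , merge (Cell i) (j , u)) →
                 proj₁ o ≡ i × proj₁ (split (Cell (proj₁ o)) (proj₂ o)) ≡ j
    components ≡.refl = ≡.refl , ≡.cong proj₁ (split-merge (Cell i) (j , u))

module LinearAlgebra {c ℓ} (F : Field c ℓ) where
  open Field F hiding (zero)
  open FieldDefs F
  open import Relation.Binary.Reasoning.Setoid setoid
  open import Algebra.Solver.Ring.NaturalCoefficients.Default commutativeSemiring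
    using (solve; _:+_; _:*_; _:=_)
  open import Induction.WellFounded using (module All)
  open import Data.Fin.Induction using (<-wellFounded)
  import Data.Nat.Properties as ℕP

  guarded : ∀ {a} {A : Set a} → Dec A → (A → Carrier) → Carrier
  guarded (yes a) h = h a
  guarded (no _)  h = 0#

  private variable
    ℓA : Level
    A  : Set ℓA

  guarded-yes : (a? : Dec A) {h : A → Carrier} {y : Carrier} → A → (∀ x → h x ≈ y) →
                guarded a? h ≈ y
  guarded-yes (yes x′) x hy = hy x′
  guarded-yes (no ¬x)  x hy = ⊥-elim (¬x x)

  guarded-no : (a? : Dec A) {h : A → Carrier} → ¬ A → guarded a? h ≈ 0#
  guarded-no (yes x) ¬x = ⊥-elim (¬x x)
  guarded-no (no _)  ¬x = refl

  guarded-cong : (a? : Dec A) {h h′ : A → Carrier} → (∀ x → h x ≈ h′ x) →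
                 guarded a? h ≈ guarded a? h′
  guarded-cong (yes x) eq = eq x
  guarded-cong (no _)  eq = refl

  guarded-+ : (a? : Dec A) (h h′ : A → Carrier) →
              guarded a? (λ x → h x + h′ x) ≈ guarded a? h + guarded a? h′
  guarded-+ (yes _) h h′ = refl
  guarded-+ (no _)  h h′ = sym (+-identityʳ 0#)

  guarded-* : (a? : Dec A) (y : Carrier) (h : A → Carrier) →
              guarded a? (λ x → y * h x) ≈ y * guarded a? h
  guarded-* (yes _) y h = refl
  guarded-* (no _)  y h = sym (zeroʳ y)

  δ : ∀ {n} → Fin n → Fin n → Carrier
  δ i j = guarded (i FinP.≟ j) (λ _ → 1#)

  δ-diag : ∀ {n} (i : Fin n) → δ i i ≈ 1#
  δ-diag i = guarded-yes (i FinP.≟ i) ≡.refl (λ _ → refl)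

  δ-off : ∀ {n} (i j : Fin n) → i ≢ j → δ i j ≈ 0#
  δ-off i j = guarded-no (i FinP.≟ j)

  lincomb-zero-coefficients : ∀ {n d} (a : Fin n → Carrier) (g : Fin n → Vec d) →
                              (∀ k → a k ≈ 0#) → lincomb a g ≋ 0v
  lincomb-zero-coefficients {ℕ.zero}  a g a≈0 q = refl
  lincomb-zero-coefficients {ℕ.suc n} a g a≈0 q = begin
    a zero * g zero q + lincomb (a ∘ suc) (g ∘ suc) q
      ≈⟨ +-cong (*-congʳ (a≈0 zero)) (lincomb-zero-coefficients (a ∘ suc) (g ∘ suc) (a≈0 ∘ suc) q) ⟩
    0# * g zero q + 0# ≈⟨ +-identityʳ _ ⟩
    0# * g zero q      ≈⟨ zeroˡ _ ⟩
    0#                 ∎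

  lincomb-zero-at : ∀ {n d} (a : Fin n → Carrier) (g : Fin n → Vec d) q →
                    (∀ k → g k q ≈ 0#) → lincomb a g q ≈ 0#
  lincomb-zero-at {ℕ.zero}  a g q g≈0 = refl
  lincomb-zero-at {ℕ.suc n} a g q g≈0 = begin
    a zero * g zero q + lincomb (a ∘ suc) (g ∘ suc) q
      ≈⟨ +-cong (*-congˡ (g≈0 zero)) (lincomb-zero-at (a ∘ suc) (g ∘ suc) q (g≈0 ∘ suc)) ⟩
    a zero * 0# + 0# ≈⟨ +-identityʳ _ ⟩
    a zero * 0#      ≈⟨ zeroʳ _ ⟩
    0#               ∎

  lincomb-single : ∀ {n d} (a : Fin n → Carrier) (g : Fin n → Vec d) j →
                   a j ≈ 1# → (∀ k → j ≢ k → a k ≈ 0#) → lincomb a g ≋ g j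
  lincomb-single {ℕ.suc n} a g zero a≈1 a≈0 q = begin
    a zero * g zero q + lincomb (a ∘ suc) (g ∘ suc) q
      ≈⟨ +-cong (*-congʳ a≈1)
                (lincomb-zero-coefficients (a ∘ suc) (g ∘ suc) (λ k → a≈0 (suc k) (λ ())) q) ⟩
    1# * g zero q + 0# ≈⟨ +-identityʳ _ ⟩
    1# * g zero q      ≈⟨ *-identityˡ _ ⟩
    g zero q           ∎
  lincomb-single {ℕ.suc n} a g (suc j) a≈1 a≈0 q = begin
    a zero * g zero q + lincomb (a ∘ suc) (g ∘ suc) q
      ≈⟨ +-cong (*-congʳ (a≈0 zero (λ ())))
                (lincomb-single (a ∘ suc) (g ∘ suc) j a≈1
                                (λ k j≢k → a≈0 (suc k) (j≢k ∘ FinP.suc-injective)) q) ⟩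
    0# * g zero q + g (suc j) q ≈⟨ +-congʳ (zeroˡ _) ⟩
    0# + g (suc j) q            ≈⟨ +-identityˡ _ ⟩
    g (suc j) q                 ∎

  lincomb-δ : ∀ {n d} (g : Fin n → Vec d) j → lincomb (δ j) g ≋ g j
  lincomb-δ g j = lincomb-single (δ j) g j (δ-diag j) (δ-off j)

  lincomb-+ : ∀ {n d} (a b : Fin n → Carrier) (g : Fin n → Vec d) →
              lincomb (λ k → a k + b k) g ≋ (lincomb a g +v lincomb b g)
  lincomb-+ {ℕ.zero}  a b g q = sym (+-identityʳ 0#)
  lincomb-+ {ℕ.suc n} a b g q = begin
    (a zero + b zero) * g zero q + lincomb (λ k → a (suc k) + b (suc k)) (g ∘ suc) q
      ≈⟨ +-congˡ (lincomb-+ (a ∘ suc) (b ∘ suc) (g ∘ suc) q) ⟩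
    (a zero + b zero) * g zero q + (restA + restB)
      ≈⟨ solve 5 (λ x y z u v → (x :+ y) :* z :+ (u :+ v) := (x :* z :+ u) :+ (y :* z :+ v)) refl
               (a zero) (b zero) (g zero q) restA restB ⟩
    (a zero * g zero q + restA) + (b zero * g zero q + restB) ∎
    where
    restA restB : Carrier
    restA = lincomb (a ∘ suc) (g ∘ suc) q
    restB = lincomb (b ∘ suc) (g ∘ suc) q

  lincomb-* : ∀ {n d} (x : Carrier) (a : Fin n → Carrier) (g : Fin n → Vec d) →
              lincomb (λ k → x * a k) g ≋ (x ·v lincomb a g)
  lincomb-* {ℕ.zero}  x a g q = sym (zeroʳ x)
  lincomb-* {ℕ.suc n} x a g q = begin
    x * a zero * g zero q + lincomb (λ k → x * a (suc k)) (g ∘ suc) q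
      ≈⟨ +-congˡ (lincomb-* x (a ∘ suc) (g ∘ suc) q) ⟩
    x * a zero * g zero q + x * rest
      ≈⟨ solve 4 (λ x y z u → x :* y :* z :+ x :* u := x :* (y :* z :+ u)) refl x (a zero) (g zero q) rest ⟩
    x * (a zero * g zero q + rest) ∎
    where
    rest : Carrier
    rest = lincomb (a ∘ suc) (g ∘ suc) q

  upTo : ∀ {n} (i : Fin n) → Fin (ℕ.suc (toℕ i)) → Fin n
  upTo i k = Fin.inject≤ k (FinP.toℕ<n i)

  lincomb-truncate : ∀ {n d} (a : Fin n → Carrier) (g : Fin n → Vec d) (i : Fin n) →
                     (∀ k → i Fin.< k → a k ≈ 0#) →
                     lincomb a g ≋ lincomb (a ∘ upTo i) (g ∘ upTo i)
  lincomb-truncate {ℕ.suc n} a g zero a≈0 q =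
    +-congˡ (lincomb-zero-coefficients (a ∘ suc) (g ∘ suc) (λ k → a≈0 (suc k) ℕ.z<s) q)
  lincomb-truncate {ℕ.suc n} a g (suc i) a≈0 q =
    +-congˡ (lincomb-truncate (a ∘ suc) (g ∘ suc) i (λ k i<k → a≈0 (suc k) (ℕ.s<s i<k)) q)

  record Unitriangular {n d} (g : Fin n → Vec d) (p : Fin n → Fin d) : Set ℓ where
    field
      pivot-one  : ∀ k → g k (p k) ≈ 1#
      pivot-zero : ∀ k m → m Fin.< k → g k (p m) ≈ 0#

  module _ {n d} {g : Fin n → Vec d} {p : Fin n → Fin d} (ut : Unitriangular g p) where
    open Unitriangular ut

    restrict : ∀ {n′} (ι : Fin n′ → Fin n) → (∀ m k → m Fin.< k → ι m Fin.< ι k) →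
               Unitriangular (g ∘ ι) (p ∘ ι)
    restrict ι ι-mono = record
      { pivot-one  = pivot-one ∘ ι
      ; pivot-zero = λ k m m<k → pivot-zero (ι k) (ι m) (ι-mono m k m<k)
      }

  pivot-coefficient : ∀ {n d} {g : Fin n → Vec d} {p : Fin n → Fin d} →
                      Unitriangular g p → ∀ a k → (∀ m → m Fin.< k → a m ≈ 0#) →
                      lincomb a g (p k) ≈ a k
  pivot-coefficient {ℕ.suc n} {g = g} {p} ut a zero _ = begin
    a zero * g zero (p zero) + lincomb (a ∘ suc) (g ∘ suc) (p zero)
      ≈⟨ +-cong (*-congˡ (pivot-one zero))
                (lincomb-zero-at (a ∘ suc) (g ∘ suc) (p zero) (λ k → pivot-zero (suc k) zero ℕ.z<s)) ⟩
    a zero * 1# + 0# ≈⟨ +-identityʳ _ ⟩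
    a zero * 1#      ≈⟨ *-identityʳ _ ⟩
    a zero           ∎
    where open Unitriangular ut
  pivot-coefficient {ℕ.suc n} {g = g} {p} ut a (suc k) a≈0 = begin
    a zero * g zero (p (suc k)) + lincomb (a ∘ suc) (g ∘ suc) (p (suc k))
      ≈⟨ +-cong (*-congʳ (a≈0 zero ℕ.z<s))
                (pivot-coefficient (restrict ut suc (λ _ _ → ℕ.s<s)) (a ∘ suc) k
                                   (λ m m<k → a≈0 (suc m) (ℕ.s<s m<k))) ⟩
    0# * g zero (p (suc k)) + a (suc k) ≈⟨ +-congʳ (zeroˡ _) ⟩
    0# + a (suc k)                      ≈⟨ +-identityˡ _ ⟩
    a (suc k)                           ∎

  module _ {n d} {g : Fin n → Vec d} {p : Fin n → Fin d} (ut : Unitriangular g p) where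

    -- Forward substitution: if Σ aₘ gₘ vanishes at p₀, …, pₖ then aₖ ≈ 0.
    coefficient-vanishes : ∀ a k → (∀ m → m Fin.≤ k → lincomb a g (p m) ≈ 0#) → a k ≈ 0#
    coefficient-vanishes a = All.wfRec <-wellFounded ℓ Vanishes step
      where
      Vanishes : Fin n → Set ℓ
      Vanishes k = (∀ m → m Fin.≤ k → lincomb a g (p m) ≈ 0#) → a k ≈ 0#
      step : ∀ k → (∀ {m} → m Fin.< k → Vanishes m) → Vanishes k
      step k ih vanish = begin
        a k               ≈⟨ sym (pivot-coefficient ut a k earlier) ⟩
        lincomb a g (p k) ≈⟨ vanish k ℕP.≤-refl ⟩
        0#                ∎
        where
        earlier : ∀ m → m Fin.< k → a m ≈ 0#
        earlier m m<k = ih m<k (λ m′ m′≤m → vanish m′ (ℕP.≤-trans m′≤m (ℕP.<⇒≤ m<k)))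

    independent : LinIndep g
    independent a Σ≈0 k = coefficient-vanishes a k (λ m _ → Σ≈0 (p m))

    leading-coefficients-vanish : ∀ {v : Vec d} a (i : Fin n) → v ≋ lincomb a g →
                                  (∀ m → m Fin.< i → v (p m) ≈ 0#) →
                                  ∀ m → m Fin.< i → a m ≈ 0#
    leading-coefficients-vanish a i v≋ v≈0 m m<i = coefficient-vanishes a m
      (λ m′ m′≤m → trans (sym (v≋ (p m′))) (v≈0 m′ (ℕP.≤-<-trans m′≤m m<i)))

  agree-at-pivots : ∀ {n d} {g : Fin n → Vec d} {p : Fin n → Fin d} →
                    Unitriangular g p → (v : Vec d) → ∃ λ a → ∀ m → lincomb a g (p m) ≈ v (p m)
  agree-at-pivots {ℕ.zero}            ut v = (λ ()) , (λ ())
  agree-at-pivots {ℕ.suc n} {g = g} {p} ut v = a , agree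
    where
    open Unitriangular ut
    lead : Carrier
    lead = v (p zero)
    -- v with its component along g₀ removed; it vanishes at p₀
    v′ : Vec _
    v′ q = v q + - (lead * g zero q)
    rest : ∃ λ a′ → ∀ m → lincomb a′ (g ∘ suc) (p (suc m)) ≈ v′ (p (suc m))
    rest = agree-at-pivots (restrict ut suc (λ _ _ → ℕ.s<s)) v′
    a : Fin (ℕ.suc n) → Carrier
    a zero    = lead
    a (suc k) = proj₁ rest k
    agree : ∀ m → lincomb a g (p m) ≈ v (p m)
    agree zero = begin
      lead * g zero (p zero) + lincomb (a ∘ suc) (g ∘ suc) (p zero)
        ≈⟨ +-cong (*-congˡ (pivot-one zero))
                  (lincomb-zero-at (a ∘ suc) (g ∘ suc) (p zero) (λ k → pivot-zero (suc k) zero ℕ.z<s)) ⟩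
      lead * 1# + 0# ≈⟨ +-identityʳ _ ⟩
      lead * 1#      ≈⟨ *-identityʳ _ ⟩
      lead           ∎
    agree (suc m) = begin
      y + lincomb (a ∘ suc) (g ∘ suc) (p (suc m)) ≈⟨ +-congˡ (proj₂ rest m) ⟩
      y + (v (p (suc m)) + - y)                   ≈⟨ +-congˡ (+-comm _ _) ⟩
      y + (- y + v (p (suc m)))                   ≈⟨ sym (+-assoc _ _ _) ⟩
      (y + - y) + v (p (suc m))                   ≈⟨ +-congʳ (-‿inverseʳ y) ⟩
      0# + v (p (suc m))                          ≈⟨ +-identityˡ _ ⟩
      v (p (suc m))                               ∎
      where
      y : Carrier
      y = lead * g zero (p (suc m))

  spans-all : ∀ {n d} {g : Fin n → Vec d} {p : Fin n → Fin d} → Unitriangular g p →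
              (∀ q → ∃ λ m → p m ≡ q) → (v : Vec d) → ∃ λ a → v ≋ lincomb a g
  spans-all {g = g} {p} ut surj v = a , λ q →
    ≡.subst (λ q → v q ≈ lincomb a g q) (proj₂ (surj q)) (sym (agree (proj₁ (surj q))))
    where
    a : Fin _ → Carrier
    a = proj₁ (agree-at-pivots ut v)
    agree : ∀ m → lincomb a g (p m) ≈ v (p m)
    agree = proj₂ (agree-at-pivots ut v)

  Span≤ : ∀ {n d} → (Fin n → Vec d) → Fin n → Subspace d
  Span≤ g i = record
    { Mem  = λ v → ∃ λ a → (∀ k → i Fin.< k → a k ≈ 0#) × v ≋ lincomb a g
    ; resp = λ { u≋v (a , a≈0 , u≋) → a , a≈0 , (λ q → trans (sym (u≋v q)) (u≋ q)) }
    ; 0∈   = (λ _ → 0#) , (λ _ _ → refl) ,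
             (λ q → sym (lincomb-zero-coefficients (λ _ → 0#) g (λ _ → refl) q))
    ; +∈   = λ { (a , a≈0 , u≋) (b , b≈0 , v≋) →
               (λ k → a k + b k) ,
               (λ k i<k → trans (+-cong (a≈0 k i<k) (b≈0 k i<k)) (+-identityʳ 0#)) ,
               (λ q → trans (+-cong (u≋ q) (v≋ q)) (sym (lincomb-+ a b g q))) }
    ; ·∈   = λ { x (a , a≈0 , u≋) →
               (λ k → x * a k) ,
               (λ k i<k → trans (*-congˡ (a≈0 k i<k)) (zeroʳ x)) ,
               (λ q → trans (*-congˡ (u≋ q)) (sym (lincomb-* x a g q))) }
    }

  module _ {n d} (g : Fin n → Vec d) where

    Span≤-member : ∀ {i j} → j Fin.≤ i → Mem (Span≤ g i) (g j)
    Span≤-member {i} {j} j≤i =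
      δ j , (λ k i<k → δ-off j k (λ { ≡.refl → ℕP.<⇒≱ i<k j≤i })) , (λ q → sym (lincomb-δ g j q))

    Span≤-mono : ∀ {i i′} → i Fin.< i′ → Span≤ g i ⊆ Span≤ g i′
    Span≤-mono i<i′ v (a , a≈0 , v≋) = a , (λ k i′<k → a≈0 k (ℕP.<-trans i<i′ i′<k)) , v≋

    Span≤-dim : ∀ {p} → Unitriangular g p → ∀ i → HasDim (Span≤ g i) (ℕ.suc (toℕ i))
    Span≤-dim ut i = g ∘ upTo i , members , independent (restrict ut (upTo i) upTo-mono) , spanning
      where
      toℕ-upTo : ∀ k → toℕ (upTo i k) ≡ toℕ k
      toℕ-upTo k = FinP.toℕ-inject≤ k (FinP.toℕ<n i)
      upTo-mono : ∀ m k → m Fin.< k → upTo i m Fin.< upTo i k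
      upTo-mono m k = ≡.subst₂ ℕ._<_ (≡.sym (toℕ-upTo m)) (≡.sym (toℕ-upTo k))
      members : ∀ k → Mem (Span≤ g i) (g (upTo i k))
      members k =
        Span≤-member (≡.subst (ℕ._≤ toℕ i) (≡.sym (toℕ-upTo k)) (ℕ.s≤s⁻¹ (FinP.toℕ<n k)))
      spanning : Spans (Span≤ g i) (g ∘ upTo i)
      spanning v (a , a≈0 , v≋) = a ∘ upTo i , λ q → trans (v≋ q) (lincomb-truncate a g i a≈0 q)

  Span≤-before : ∀ {d} (g : Fin d → Vec d) {i i′} → i′ Fin.< i → Span≤ g i′ ⊆Span g before i
  Span≤-before g i′<i v (a , a≈0 , v≋) = a , (λ k i≤k → a≈0 k (ℕP.<-≤-trans i′<i i≤k)) , v≋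

  Span≤-flag : ∀ {k d} {g : Fin (ℕ.suc k) → Vec d} {p} → Unitriangular g p → k ℕ.< d →
               IsFlag (Span≤ g)
  Span≤-flag {k} {g = g} ut k<d =
    (λ i → ℕ.suc (toℕ i)) , Span≤-dim g ut , (λ i j → Span≤-mono g) , (λ i j → ℕ.s<s) ,
    ℕ.z<s , ≡.subst (λ x → ℕ.suc x ℕ.≤ _) (≡.sym (FinP.toℕ-fromℕ k)) k<d

  Span≤-last : ∀ {k d} (g : Fin (ℕ.suc k) → Vec d) → (∀ v → ∃ λ a → v ≋ lincomb a g) →
               Full d ⊆ Span≤ g (fromℕ k)
  Span≤-last {k} g spans v _ = proj₁ (spans v) , beyond-last , proj₂ (spans v)
    where
    beyond-last : ∀ j → fromℕ k Fin.< j → proj₁ (spans v) j ≈ 0#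
    beyond-last j k<j = ⊥-elim (ℕP.<⇒≱ k<j (≡.subst (toℕ j ℕ.≤_) (≡.sym (FinP.toℕ-fromℕ k))
                                                   (ℕ.s≤s⁻¹ (FinP.toℕ<n j))))

module Echelon {c ℓ} (F : Field c ℓ) {d} (π : Permutation′ d) where
  open Field F hiding (zero)
  open FieldDefs F
  open LinearAlgebra F
  open Inversions π
  open import Relation.Binary.Reasoning.Setoid setoid
  open import Relation.Binary.Definitions using (tri<; tri≈; tri>)
  import Data.Nat.Properties as ℕP

  -- fᵢ has entry 1 at π(i), vanishes at π(k) for k < i, and vanishes beyond
  -- position π(i): these are exactly the shapes of canonical bases.
  record IsEchelon (f : Fin d → Vec d) : Set ℓ where
    field
      unitriangular : Unitriangular f (π ⟨$⟩ʳ_)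
      beyond-pivot  : ∀ i q → π ⟨$⟩ʳ i Fin.< q → f i q ≈ 0#
    open Unitriangular unitriangular public

  π-injective : ∀ {i j} → π ⟨$⟩ʳ i ≡ π ⟨$⟩ʳ j → i ≡ j
  π-injective {i} {j} eq =
    ≡.trans (≡.sym (inverseˡ π)) (≡.trans (≡.cong (π ⟨$⟩ˡ_) eq) (inverseˡ π))

  Fixed : (Fin d → Vec d) → Set ℓ
  Fixed f = ∀ i j → ¬ Inversion i j → f i (π ⟨$⟩ʳ j) ≈ δ i j

  echelon⇒fixed : ∀ {f} → IsEchelon f → Fixed f
  echelon⇒fixed ech i j ¬inv with FinP.<-cmp i j
  ... | tri≈ _ ≡.refl _ = trans (pivot-one i) (sym (δ-diag i))
    where open IsEchelon ech
  ... | tri> _ _ j<i = trans (pivot-zero i j j<i) (sym (δ-off i j (≡.≢-sym (FinP.<⇒≢ j<i))))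
    where open IsEchelon ech
  ... | tri< i<j _ _ = trans (beyond-pivot i _ πi<πj) (sym (δ-off i j (FinP.<⇒≢ i<j)))
    where
    open IsEchelon ech
    πi<πj : π ⟨$⟩ʳ i Fin.< π ⟨$⟩ʳ j
    πi<πj with FinP.<-cmp (π ⟨$⟩ʳ i) (π ⟨$⟩ʳ j)
    ... | tri< lt _ _ = lt
    ... | tri≈ _ eq _ = ⊥-elim (FinP.<⇒≢ i<j (π-injective eq))
    ... | tri> _ _ gt = ⊥-elim (¬inv (i<j , gt))

  fixed⇒echelon : ∀ {f} → Fixed f → IsEchelon f
  fixed⇒echelon {f} fixed = record
    { unitriangular = record
      { pivot-one  = λ i → trans (fixed i i (λ (i<i , _) → ℕP.<-irrefl ≡.refl i<i)) (δ-diag i)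
      ; pivot-zero = λ i k k<i → trans (fixed i k (λ (i<k , _) → ℕP.<-asym i<k k<i))
                                       (δ-off i k (λ { ≡.refl → ℕP.<-irrefl ≡.refl k<i }))
      }
    ; beyond-pivot = beyond
    }
    where
    beyond : ∀ i q → π ⟨$⟩ʳ i Fin.< q → f i q ≈ 0#
    beyond i q πi<q = ≡.subst (λ q → f i q ≈ 0#) (inverseʳ π) (begin
      f i (π ⟨$⟩ʳ j) ≈⟨ fixed i j (λ (_ , πj<πi) → ℕP.<-asym πi<πj πj<πi) ⟩
      δ i j          ≈⟨ δ-off i j (λ { ≡.refl → ℕP.<-irrefl ≡.refl πi<πj }) ⟩
      0#             ∎)
      where
      j : Fin d
      j = π ⟨$⟩ˡ q
      πi<πj : π ⟨$⟩ʳ i Fin.< π ⟨$⟩ʳ j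
      πi<πj = ≡.subst (π ⟨$⟩ʳ i Fin.<_) (≡.sym (inverseʳ π)) πi<q

  -- A canonical basis has echelon shape: its defining admissibility
  -- conditions say precisely this, whatever the flag.
  canonical⇒echelon : ∀ {m} {W : Fin m → Subspace d} {f} → IsCanonicalFor W f π → IsEchelon f
  canonical⇒echelon {W = W} {f} canonical = record
    { unitriangular = record
      { pivot-one  = λ i → let (_ , _ , _ , one) = admissible i in one
      ; pivot-zero = λ i → let (_ , zero-before , _ , _) = admissible i in zero-before
      }
    ; beyond-pivot = λ i → let (_ , _ , (_ , zero-after) , _) = admissible i in zero-after
    }
    where
    admissible : ∀ i → Admissible (W (proj₁ (canonical i))) π i (f i) (π ⟨$⟩ʳ i)
    admissible i = let (_ , _ , _ , adm , _) = canonical i in adm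

  inB⇒echelon : ∀ {f} → InB π f → IsEchelon f
  inB⇒echelon (_ , _ , V , _ , inj₁ (_ , canonical)) = canonical⇒echelon {W = V} canonical
  inB⇒echelon (_ , _ , V , _ , inj₂ (_ , canonical)) =
    canonical⇒echelon {W = append V (Full d)} canonical

-- Conversely, an echelon family f is the canonical basis, with length-permutation
-- π, of the complete flag Span≤ f 0 ⊂ … ⊂ Span≤ f m (here d = m + 1).
module EchelonIsCanonical {c ℓ} (F : Field c ℓ) {m} (π : Permutation′ (ℕ.suc m))
                          (f : Fin (ℕ.suc m) → FieldDefs.Vec F (ℕ.suc m))
                          (ech : Echelon.IsEchelon F π f) where
  open Field F hiding (zero)
  open FieldDefs F
  open LinearAlgebra F
  open Echelon F π
  open IsEchelon ech
  open import Relation.Binary.Reasoning.Setoid setoid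
  open import Relation.Binary.Definitions using (tri<; tri≈; tri>)
  import Data.Nat.Properties as ℕP

  d : ℕ
  d = ℕ.suc m

  -- The pivots π(0), …, π(m) exhaust all positions, so f spans F^d.
  spans : ∀ v → ∃ λ a → v ≋ lincomb a f
  spans = spans-all unitriangular (λ q → π ⟨$⟩ˡ q , inverseʳ π)

  isBasis : IsBasis f
  isBasis = independent unitriangular , (λ v _ → spans v)

  vanish-everywhere : ∀ (a : Fin d → Carrier) i → (∀ k → k Fin.< i → a k ≈ 0#) → a i ≈ 0# →
                      (∀ k → i Fin.< k → a k ≈ 0#) → ∀ k → a k ≈ 0#
  vanish-everywhere a i before at after k with FinP.<-cmp k i
  ... | tri< k<i _ _     = before k k<i
  ... | tri≈ _ ≡.refl _  = at
  ... | tri> _ _ i<k     = after k i<k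

  new-vector : ∀ i → ¬ (Span≤ f i ⊆Span f before i)
  new-vector i ⊆before = 1≉0 (begin
    1#                     ≈⟨ sym (pivot-one i) ⟩
    f i (π ⟨$⟩ʳ i)         ≈⟨ f≋ (π ⟨$⟩ʳ i) ⟩
    lincomb a f (π ⟨$⟩ʳ i) ≈⟨ lincomb-zero-coefficients a f a≈0 (π ⟨$⟩ʳ i) ⟩
    0#                     ∎)
    where
    in-span : InSpanBefore f i (f i)
    in-span = ⊆before (f i) (Span≤-member f ℕP.≤-refl)
    a : Fin d → Carrier
    a = proj₁ in-span
    f≋ : f i ≋ lincomb a f
    f≋ = proj₂ (proj₂ in-span)
    a≈0 : ∀ k → a k ≈ 0#
    a≈0 = vanish-everywhere a i
      (leading-coefficients-vanish unitriangular a i f≋ (pivot-zero i))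
      (proj₁ (proj₂ in-span) i ℕP.≤-refl)
      (λ k i<k → proj₁ (proj₂ in-span) k (ℕP.<⇒≤ i<k))

  minimal : ∀ i v p → Admissible (Span≤ f i) π i v p → π ⟨$⟩ʳ i Fin.≤ p
  minimal i v p ((a , a≈0 , v≋) , v-before , (vp≉0 , v-after) , _) with π ⟨$⟩ʳ i FinP.≤? p
  ... | yes πi≤p = πi≤p
  ... | no  πi≰p = ⊥-elim (vp≉0 (trans (v≋ p) (lincomb-zero-coefficients a f all-zero p)))
    where
    leading : ∀ k → k Fin.< i → a k ≈ 0#
    leading = leading-coefficients-vanish unitriangular a i v≋ v-before
    all-zero : ∀ k → a k ≈ 0#
    all-zero = vanish-everywhere a i leading (begin
      a i                    ≈⟨ sym (pivot-coefficient unitriangular a i leading) ⟩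
      lincomb a f (π ⟨$⟩ʳ i) ≈⟨ sym (v≋ (π ⟨$⟩ʳ i)) ⟩
      v (π ⟨$⟩ʳ i)           ≈⟨ v-after (π ⟨$⟩ʳ i) (ℕP.≰⇒> πi≰p) ⟩
      0#                     ∎) a≈0

  canonical : IsCanonicalFor (Span≤ f) f π
  canonical i =
    i , new-vector i , (λ i′ i′<i → Span≤-before f i′<i) ,
    (Span≤-member f ℕP.≤-refl , pivot-zero i ,
     ((λ one≈0 → 1≉0 (trans (sym (pivot-one i)) one≈0)) , beyond-pivot i) , pivot-one i) ,
    minimal i

  inB : InB π f
  inB = isBasis , m , Span≤ f , Span≤-flag unitriangular ℕP.≤-refl ,
        inj₁ (Span≤-last f spans , canonical)

module Parametrisation {c ℓ} (F : Field c ℓ) {d} (π : Permutation′ d) where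
  open Field F hiding (zero)
  open FieldDefs F
  open LinearAlgebra F
  open Inversions π
  open Echelon F π
  open import Relation.Binary.Reasoning.Setoid setoid

  entry : Vec (inv π) → Fin d → Fin d → Carrier
  entry x i j = guarded (inversion? i j) (x ∘ indexOf)

  entry-inversion : ∀ x {i j} (p : Inversion i j) → entry x i j ≈ x (indexOf p)
  entry-inversion x {i} {j} p =
    guarded-yes (inversion? i j) p (λ q → reflexive (≡.cong x (indexOf-irrelevant q p)))

  base : Fin d → Vec d
  base i q = δ i (π ⟨$⟩ˡ q)

  linear-part : Vec (inv π) → Fin d → Vec d
  linear-part x i q = entry x i (π ⟨$⟩ˡ q)

  φ : Vec (inv π) → Fin d → Vec d
  φ x i = base i +v linear-part x i

  linear-part-linear : IsLinear linear-part
  linear-part-linear =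
    (λ x y x≋y i q → guarded-cong (inversion? i (π ⟨$⟩ˡ q)) (x≋y ∘ indexOf)) ,
    (λ x y i q → guarded-+ (inversion? i (π ⟨$⟩ˡ q)) (x ∘ indexOf) (y ∘ indexOf)) ,
    (λ a x i q → guarded-* (inversion? i (π ⟨$⟩ˡ q)) a (x ∘ indexOf))

  φ-at : ∀ x i j → φ x i (π ⟨$⟩ʳ j) ≈ δ i j + entry x i j
  φ-at x i j = reflexive (≡.cong (λ j′ → δ i j′ + entry x i j′) (inverseˡ π))

  φ-fixed : ∀ x → Fixed (φ x)
  φ-fixed x i j ¬inv = begin
    φ x i (π ⟨$⟩ʳ j)  ≈⟨ φ-at x i j ⟩
    δ i j + entry x i j ≈⟨ +-congˡ (guarded-no (inversion? i j) ¬inv) ⟩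
    δ i j + 0#        ≈⟨ +-identityʳ _ ⟩
    δ i j             ∎

  φ-free : ∀ x {i j} (p : Inversion i j) → φ x i (π ⟨$⟩ʳ j) ≈ x (indexOf p)
  φ-free x {i} {j} p@(i<j , _) = begin
    φ x i (π ⟨$⟩ʳ j)    ≈⟨ φ-at x i j ⟩
    δ i j + entry x i j ≈⟨ +-cong (δ-off i j (FinP.<⇒≢ i<j)) (entry-inversion x p) ⟩
    0# + x (indexOf p)  ≈⟨ +-identityˡ _ ⟩
    x (indexOf p)       ∎

  φ-injective : ∀ x y → (∀ i → φ x i ≋ φ y i) → x ≋ y
  φ-injective x y φx≋φy t = begin
    x t                  ≡⟨ ≡.cong x (≡.sym (indexOf-inversionAt t p)) ⟩
    x (indexOf p)        ≈⟨ sym (φ-free x p) ⟩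
    φ x i (π ⟨$⟩ʳ j)     ≈⟨ φx≋φy i (π ⟨$⟩ʳ j) ⟩
    φ y i (π ⟨$⟩ʳ j)     ≈⟨ φ-free y p ⟩
    y (indexOf p)        ≡⟨ ≡.cong y (indexOf-inversionAt t p) ⟩
    y t                  ∎
    where
    i j : Fin d
    i = proj₁ (inversionAt t)
    j = proj₁ (proj₂ (inversionAt t))
    p : Inversion i j
    p = proj₂ (proj₂ (inversionAt t))

  coordinates : (Fin d → Vec d) → Vec (inv π)
  coordinates f t = let (i , j , _) = inversionAt t in f i (π ⟨$⟩ʳ j)

  φ-surjective : ∀ f → IsEchelon f → ∀ i → φ (coordinates f) i ≋ f i
  φ-surjective f ech i q = ≡.subst (λ q → φ x i q ≈ f i q) (inverseʳ π) (at-pivot (π ⟨$⟩ˡ q))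
    where
    x : Vec (inv π)
    x = coordinates f
    at-pivot : ∀ j → φ x i (π ⟨$⟩ʳ j) ≈ f i (π ⟨$⟩ʳ j)
    at-pivot j with inversion? i j
    ... | yes p = begin
      φ x i (π ⟨$⟩ʳ j) ≈⟨ φ-free x p ⟩
      x (indexOf p)    ≡⟨ ≡.cong₂ (λ i′ j′ → f i′ (π ⟨$⟩ʳ j′)) (proj₁ (inversionAt-indexOf p))
                                                               (proj₂ (inversionAt-indexOf p)) ⟩
      f i (π ⟨$⟩ʳ j)   ∎
    ... | no ¬p = trans (φ-fixed x i j ¬p) (sym (echelon⇒fixed ech i j ¬p))

proposition10p1 : ∀ {c ℓ} (F : Field c ℓ) (d : ℕ) → 1 ≤ d → (π : Permutation′ d) →
    FieldDefs.AffineParametrisation F (FieldDefs.InB F π) (inv π)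
proposition10p1 F (ℕ.suc m) _ π =
  base , linear-part , linear-part-linear ,
  (λ x → EchelonIsCanonical.inB F π (φ x) (fixed⇒echelon (φ-fixed x))) ,
  φ-injective ,
  (λ f f∈B → coordinates f , φ-surjective f (inB⇒echelon f∈B))
  where
  open Parametrisation F π
  open Echelon F π
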